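{- Let $G=(V,E)$ be a finite graph of degree $d$ and let $S\subseteq V$. Then $$|\mathsf{VC}(G,S)|\leq\left(\frac{2^d}{1+2^d}\right)^{|S|}|\mathsf{VC}(G)|.$$
   Context: The degree of $G$ is the maximum number of neighbours of a vertex. A vertex cover of $G$ is a set $C\subseteq V$ meeting every edge. $\mathsf{VC}(G)$ is the set of vertex covers of $G$, and $\mathsf{VC}(G,S)$ the set of vertex covers of $G$ containing $S$. -}

module Defs where

open import Data.Nat using (ℕ; zero; suc; _⊔_)
open import Data.Bool using (Bool; true; false)
open import Data.Fin using (Fin)
open import Data.Fin.Subset using (Subset; _∈_; _⊆_; ∣_∣)
open import Data.Fin.Subset.Properties using (_∈?_; _⊆?_)
open import Data.Fin.Properties using (all?)
open import Data.Sum using (_⊎_)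
open import Data.List using (List; []; _∷_; map; _++_; length; filter; foldr; allFin)
open import Data.Vec using (_∷_; []; tabulate)
open import Relation.Nullary using (Dec; ¬_; does)
open import Relation.Nullary.Decidable using (_×-dec_; _⊎-dec_; _→-dec_)
open import Relation.Binary.PropositionalEquality using (_≡_)
open import Data.Product using (_×_)

record Graph (n : ℕ) : Set₁ where
  field
    Adj      : Fin n → Fin n → Set
    adj?     : ∀ i j → Dec (Adj i j)
    sym      : ∀ {i j} → Adj i j → Adj j i
    irrefl   : ∀ {i} → ¬ Adj i i

open Graph public

neighbours : ∀ {n} (G : Graph n) → Fin n → Subset n
neighbours G i = tabulate (λ j → does (adj? G i j))

-- degree of G : maximum number of neighbours of a vertex (0 if no vertices)
degree : ∀ {n} → Graph n → ℕ
degree {n} G = foldr (λ i m → ∣ neighbours G i ∣ ⊔ m) 0 (allFin n)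

IsVertexCover : ∀ {n} → Graph n → Subset n → Set
IsVertexCover G C = ∀ i j → Adj G i j → (i ∈ C) ⊎ (j ∈ C)

isVertexCover? : ∀ {n} (G : Graph n) (C : Subset n) → Dec (IsVertexCover G C)
isVertexCover? G C =
  all? (λ i → all? (λ j → adj? G i j →-dec ((i ∈? C) ⊎-dec (j ∈? C))))

allSubsets : (n : ℕ) → List (Subset n)
allSubsets zero    = [] ∷ []
allSubsets (suc n) = map (false ∷_) (allSubsets n) ++ map (true ∷_) (allSubsets n)

numVC : ∀ {n} → Graph n → ℕ
numVC {n} G = length (filter (isVertexCover? G) (allSubsets n))

numVCcontaining : ∀ {n} → Graph n → Subset n → ℕ
numVCcontaining {n} G S =
  length (filter (λ C → (S ⊆? C) ×-dec isVertexCover? G C) (allSubsets n))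

-- Pick v ∈ S and send a cover C ⊇ S to C′ = (C - v) ∪ N(v). Then C′ is again a cover, contains
-- S - v but not v, and C is recovered from C′ up to C ∩ N(v), so at most 2^d covers containing S
-- share the same C′. Covers of G containing S and covers containing S - v but not v are disjoint
-- families of covers containing S - v, hence (1 + 2^d) |VC(G,S)| ≤ 2^d |VC(G,S - v)|; induction
-- on |S| gives the bound.
module Submission where

open import Defs hiding (sym)
open import Data.Bool using (false; true)
open import Data.Fin as Fin using (Fin)
open import Data.Fin.Properties using (_≟_)
open import Data.Fin.Subset using (Subset; _∈_; _∉_; _⊆_; _─_; _-_; _∪_; ⁅_⁆; ∣_∣; inside; outside)
open import Data.Fin.Subset.Properties
  using (_∈?_; _⊆?_; drop-∷-⊆; p─⊥≡p; p─q⊆p; x∈p∧x∉q⇒x∈p─q; x∈p∧x≢y⇒x∈p-y; x∈⁅x⁆; x∈⁅y⁆⇒x≡y;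
         x∈p∪q⁻; x∈p∪q⁺; p⊆p∪q; nonempty?; Empty-unique; ∣⊥∣≡0)
open import Data.List using (List; []; _∷_; _++_; map; length; filter; foldr)
open import Data.List.Properties using (filter-++; length-++; filter-none)
import Data.List.Membership.Propositional as List
open import Data.List.Membership.Propositional.Properties using (∈-allFin)
open import Data.List.Relation.Unary.All using (universal)
import Data.List.Relation.Unary.Any as Any
open import Data.List.Relation.Binary.Sublist.Propositional using (⊆-refl)
open import Data.List.Relation.Binary.Sublist.Propositional.Properties using (filter⁺; length-mono-≤)
open import Data.Nat using (ℕ; zero; suc; _+_; _*_; _^_; _≤_; _⊔_)
open import Data.Nat.Properties
  using (suc-injective; +-suc; +-comm; +-identityʳ; *-comm; *-assoc; *-identityˡ; *-identityʳ;
         *-distribˡ-+; ≤-reflexive; ≤-trans; +-mono-≤; +-monoˡ-≤; *-monoˡ-≤; *-monoʳ-≤; ^-monoʳ-≤;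
         m≤m+n; m≤n+m; m≤n*m; m≤m⊔n; m≤n⊔m; module ≤-Reasoning)
open import Data.Product using (_×_; _,_; proj₁; proj₂; map₁)
open import Data.Sum using (inj₁; inj₂)
open import Data.Vec using ([]; _∷_; here; there; lookup; tabulate)
open import Data.Vec.Properties using (lookup∘tabulate; []=⇒lookup; lookup⇒[]=)
open import Function using (_∘_)
open import Relation.Binary.PropositionalEquality
  using (_≡_; refl; sym; trans; cong; cong₂; subst; subst₂; module ≡-Reasoning)
open import Relation.Nullary using (yes; no; ¬_; contradiction)
open import Relation.Nullary.Decidable using (_×-dec_; dec-true; dec-false)
open import Relation.Unary using (Pred; Decidable)
open import Relation.Unary.Properties using (_∩?_; ∁?)

private
  variable
    n : ℕ

module _ {a p r} {A : Set a} {P : Pred A p} {R : Pred A r} (P? : Decidable P) (R? : Decidable R) where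

  length-filter-partition : ∀ xs →
    length (filter (P? ∩? R?) xs) + length (filter (P? ∩? ∁? R?) xs) ≡ length (filter P? xs)
  length-filter-partition [] = refl
  length-filter-partition (x ∷ xs) with P? x | R? x
  ... | yes _ | yes _ = cong suc (length-filter-partition xs)
  ... | yes _ | no _  = trans (+-suc _ _) (cong suc (length-filter-partition xs))
  ... | no _  | yes _ = length-filter-partition xs
  ... | no _  | no _  = length-filter-partition xs

length-filter-map : ∀ {a b p} {A : Set a} {B : Set b} {P : Pred B p} (P? : Decidable P) (f : A → B) xs →
  length (filter P? (map f xs)) ≡ length (filter (P? ∘ f) xs)
length-filter-map P? f [] = refl
length-filter-map P? f (x ∷ xs) with P? (f x)
... | yes _ = cong suc (length-filter-map P? f xs)
... | no _  = length-filter-map P? f xs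

count : ∀ {p} {P : Pred (Subset n) p} → Decidable P → ℕ
count {n} P? = length (filter P? (allSubsets n))

module _ {p q} {P : Pred (Subset n) p} {Q : Pred (Subset n) q} (P? : Decidable P) (Q? : Decidable Q) where

  count-mono : (∀ {C} → P C → Q C) → count P? ≤ count Q?
  count-mono P⇒Q = length-mono-≤ (filter⁺ P? Q? (λ { refl → P⇒Q }) (⊆-refl {x = allSubsets n}))

  count-partition : count (P? ∩? Q?) + count (P? ∩? ∁? Q?) ≡ count P?
  count-partition = length-filter-partition P? Q? (allSubsets n)

count-empty : ∀ {p} {P : Pred (Subset n) p} (P? : Decidable P) → (∀ C → ¬ P C) → count P? ≡ 0
count-empty {n} P? ¬P = cong length (filter-none P? (universal ¬P (allSubsets n)))

count-∷ : ∀ {p} {P : Pred (Subset (suc n)) p} (P? : Decidable P) →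
  count P? ≡ count (P? ∘ (false ∷_)) + count (P? ∘ (true ∷_))
count-∷ {n} P? = begin
  length (filter P? (map (false ∷_) Cs ++ map (true ∷_) Cs))
    ≡⟨ cong length (filter-++ P? (map (false ∷_) Cs) _) ⟩
  length (filter P? (map (false ∷_) Cs) ++ filter P? (map (true ∷_) Cs))
    ≡⟨ length-++ (filter P? (map (false ∷_) Cs)) ⟩
  length (filter P? (map (false ∷_) Cs)) + length (filter P? (map (true ∷_) Cs))
    ≡⟨ cong₂ _+_ (length-filter-map P? (false ∷_) Cs) (length-filter-map P? (true ∷_) Cs) ⟩
  count (P? ∘ (false ∷_)) + count (P? ∘ (true ∷_)) ∎
  where
  open ≡-Reasoning
  Cs = allSubsets n

x∈p─q⇒x∉q : ∀ {x : Fin n} (p q : Subset n) → x ∈ p ─ q → x ∉ q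
x∈p─q⇒x∉q (_ ∷ p) (outside ∷ q) (there x∈p─q) (there x∈q) = x∈p─q⇒x∉q p q x∈p─q x∈q
x∈p─q⇒x∉q (_ ∷ p) (inside  ∷ q) (there x∈p─q) (there x∈q) = x∈p─q⇒x∉q p q x∈p─q x∈q

p⊆q⇒p─r⊆q─r : ∀ {p q : Subset n} (r : Subset n) → p ⊆ q → p ─ r ⊆ q ─ r
p⊆q⇒p─r⊆q─r {p = p} r p⊆q x∈p─r = x∈p∧x∉q⇒x∈p─q (p⊆q (p─q⊆p p r x∈p─r)) (x∈p─q⇒x∉q p r x∈p─r)

x∈p⇒∣p∣≡1+∣p-x∣ : ∀ {x : Fin n} {p : Subset n} → x ∈ p → ∣ p ∣ ≡ suc ∣ p - x ∣
x∈p⇒∣p∣≡1+∣p-x∣ {p = _ ∷ p} here = cong (suc ∘ ∣_∣) (sym (p─⊥≡p p))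
x∈p⇒∣p∣≡1+∣p-x∣ {p = inside  ∷ _} (there x∈p) = cong suc (x∈p⇒∣p∣≡1+∣p-x∣ x∈p)
x∈p⇒∣p∣≡1+∣p-x∣ {p = outside ∷ _} (there x∈p) = x∈p⇒∣p∣≡1+∣p-x∣ x∈p

-- When R ⊆ C, the map C ↦ (C ─ R) ∪ N forgets only C ∩ N, so its fibres have at most 2^∣N∣ elements.
count-≤-2^∣N∣*count : ∀ {p q} {P : Pred (Subset n) p} {Q : Pred (Subset n) q}
  (R N : Subset n) (P? : Decidable P) (Q? : Decidable Q) →
  (∀ {C} → P C → R ⊆ C × Q ((C ─ R) ∪ N)) → count P? ≤ 2 ^ ∣ N ∣ * count Q?
count-≤-2^∣N∣*count [] [] P? Q? h =
  ≤-trans (count-mono P? Q? λ { {[]} p → proj₂ (h p) }) (≤-reflexive (sym (*-identityˡ _)))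
count-≤-2^∣N∣*count {P = P} {Q} (r ∷ R) (m ∷ N) P? Q? h =
  subst₂ _≤_ (sym (count-∷ P?)) (cong (2 ^ ∣ m ∷ N ∣ *_) (sym (count-∷ Q?))) (by-head r m h)
  where
  open ≤-Reasoning
  p₀ = count (P? ∘ (false ∷_))
  p₁ = count (P? ∘ (true ∷_))
  q₀ = count (Q? ∘ (false ∷_))
  q₁ = count (Q? ∘ (true ∷_))
  x = 2 ^ ∣ N ∣

  p₀≡0 : (∀ {C} → P C → Fin.zero ∈ C) → p₀ ≡ 0
  p₀≡0 P⇒0∈ = count-empty (P? ∘ (false ∷_)) λ _ p → contradiction (P⇒0∈ p) λ ()

  by-head : ∀ r m → (∀ {C} → P C → (r ∷ R) ⊆ C × Q ((C ─ (r ∷ R)) ∪ (m ∷ N))) →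
    p₀ + p₁ ≤ 2 ^ ∣ m ∷ N ∣ * (q₀ + q₁)
  by-head outside outside h = begin
    p₀ + p₁             ≤⟨ +-mono-≤ (count-≤-2^∣N∣*count R N _ (Q? ∘ (false ∷_)) (map₁ drop-∷-⊆ ∘ h))
                                    (count-≤-2^∣N∣*count R N _ (Q? ∘ (true ∷_)) (map₁ drop-∷-⊆ ∘ h)) ⟩
    x * q₀ + x * q₁     ≡⟨ *-distribˡ-+ x q₀ q₁ ⟨
    x * (q₀ + q₁)       ∎
  by-head outside inside h = begin
    p₀ + p₁             ≤⟨ +-mono-≤ (count-≤-2^∣N∣*count R N _ (Q? ∘ (true ∷_)) (map₁ drop-∷-⊆ ∘ h))
                                    (count-≤-2^∣N∣*count R N _ (Q? ∘ (true ∷_)) (map₁ drop-∷-⊆ ∘ h)) ⟩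
    x * q₁ + x * q₁     ≡⟨ cong (x * q₁ +_) (+-identityʳ (x * q₁)) ⟨
    2 * (x * q₁)        ≡⟨ *-assoc 2 x q₁ ⟨
    (2 * x) * q₁        ≤⟨ *-monoʳ-≤ (2 * x) (m≤n+m q₁ q₀) ⟩
    (2 * x) * (q₀ + q₁) ∎
  by-head inside outside h = begin
    p₀ + p₁             ≡⟨ cong (_+ p₁) (p₀≡0 λ p → proj₁ (h p) here) ⟩
    p₁                  ≤⟨ count-≤-2^∣N∣*count R N _ (Q? ∘ (false ∷_)) (map₁ drop-∷-⊆ ∘ h) ⟩
    x * q₀              ≤⟨ *-monoʳ-≤ x (m≤m+n q₀ q₁) ⟩
    x * (q₀ + q₁)       ∎
  by-head inside inside h = begin
    p₀ + p₁             ≡⟨ cong (_+ p₁) (p₀≡0 λ p → proj₁ (h p) here) ⟩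
    p₁                  ≤⟨ count-≤-2^∣N∣*count R N _ (Q? ∘ (true ∷_)) (map₁ drop-∷-⊆ ∘ h) ⟩
    x * q₁              ≤⟨ *-monoʳ-≤ x (m≤n+m q₁ q₀) ⟩
    x * (q₀ + q₁)       ≤⟨ *-monoˡ-≤ (q₀ + q₁) (m≤n*m x 2) ⟩
    (2 * x) * (q₀ + q₁) ∎

∈⇒≤foldr-⊔ : ∀ {a} {A : Set a} (f : A → ℕ) {x} {xs : List A} → x List.∈ xs →
  f x ≤ foldr (λ y m → f y ⊔ m) 0 xs
∈⇒≤foldr-⊔ f {xs = y ∷ _} (Any.here refl) = m≤m⊔n (f y) _
∈⇒≤foldr-⊔ f {xs = y ∷ _} (Any.there x∈xs) = ≤-trans (∈⇒≤foldr-⊔ f x∈xs) (m≤n⊔m (f y) _)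

module _ (G : Graph n) where

  ∣neighbours∣≤degree : ∀ v → ∣ neighbours G v ∣ ≤ degree G
  ∣neighbours∣≤degree v = ∈⇒≤foldr-⊔ (∣_∣ ∘ neighbours G) (∈-allFin v)

  adj⇒∈neighbours : ∀ {v w} → Adj G v w → w ∈ neighbours G v
  adj⇒∈neighbours {v} {w} vw =
    lookup⇒[]= w (neighbours G v) (trans (lookup∘tabulate _ w) (dec-true (adj? G v w) vw))

  v∉neighbours : ∀ {v} → v ∉ neighbours G v
  v∉neighbours {v} v∈N = contradiction (trans (sym ([]=⇒lookup v∈N)) lookup≡false) λ ()
    where
    lookup≡false : lookup (neighbours G v) v ≡ false
    lookup≡false = trans (lookup∘tabulate _ v) (dec-false (adj? G v v) (irrefl G))

  cover-v↦neighbours : ∀ {C} v → IsVertexCover G C → IsVertexCover G ((C - v) ∪ neighbours G v)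
  cover-v↦neighbours {C} v cover i j ij with i ≟ v | j ≟ v
  ... | yes refl | _        = inj₂ (x∈p∪q⁺ (inj₂ (adj⇒∈neighbours ij)))
  ... | no _     | yes refl = inj₁ (x∈p∪q⁺ (inj₂ (adj⇒∈neighbours (Graph.sym G ij))))
  ... | no i≢v   | no j≢v with cover i j ij
  ...   | inj₁ i∈C = inj₁ (x∈p∪q⁺ (inj₁ (x∈p∧x≢y⇒x∈p-y i∈C i≢v)))
  ...   | inj₂ j∈C = inj₂ (x∈p∪q⁺ (inj₁ (x∈p∧x≢y⇒x∈p-y j∈C j≢v)))

  v∉[C-v]∪neighbours : ∀ {C} v → v ∉ (C - v) ∪ neighbours G v
  v∉[C-v]∪neighbours {C} v v∈ with x∈p∪q⁻ (C - v) (neighbours G v) v∈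
  ... | inj₁ v∈C-v = x∈p─q⇒x∉q C ⁅ v ⁆ v∈C-v (x∈⁅x⁆ v)
  ... | inj₂ v∈N   = v∉neighbours v∈N

  covers⊇? : (S : Subset n) → Decidable (λ C → S ⊆ C × IsVertexCover G C)
  covers⊇? S C = (S ⊆? C) ×-dec isVertexCover? G C

  numVCavoiding : Subset n → Fin n → ℕ
  numVCavoiding S v = count (covers⊇? S ∩? ∁? (v ∈?_))

  numVCcontaining≤2^degree*numVCavoiding : ∀ {S} v → v ∈ S →
    numVCcontaining G S ≤ 2 ^ degree G * numVCavoiding (S - v) v
  numVCcontaining≤2^degree*numVCavoiding {S} v v∈S = ≤-trans
    (count-≤-2^∣N∣*count ⁅ v ⁆ (neighbours G v) (covers⊇? S) (covers⊇? (S - v) ∩? ∁? (v ∈?_)) image)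
    (*-monoˡ-≤ _ (^-monoʳ-≤ 2 (∣neighbours∣≤degree v)))
    where
    image : ∀ {C} → S ⊆ C × IsVertexCover G C →
      ⁅ v ⁆ ⊆ C × ((S - v ⊆ (C - v) ∪ neighbours G v × IsVertexCover G ((C - v) ∪ neighbours G v))
                   × v ∉ (C - v) ∪ neighbours G v)
    image {C} (S⊆C , cover) =
      (λ x∈⁅v⁆ → subst (_∈ C) (sym (x∈⁅y⁆⇒x≡y v x∈⁅v⁆)) (S⊆C v∈S)) ,
      (p⊆p∪q (neighbours G v) ∘ p⊆q⇒p─r⊆q─r ⁅ v ⁆ S⊆C , cover-v↦neighbours v cover) ,
      v∉[C-v]∪neighbours v

  numVCcontaining+numVCavoiding≤numVCcontaining : ∀ {S} v → v ∈ S →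
    numVCcontaining G S + numVCavoiding (S - v) v ≤ numVCcontaining G (S - v)
  numVCcontaining+numVCavoiding≤numVCcontaining {S} v v∈S = begin
    numVCcontaining G S + numVCavoiding (S - v) v
      ≤⟨ +-monoˡ-≤ _ (count-mono (covers⊇? S) (covers⊇? (S - v) ∩? (v ∈?_))
           λ (S⊆C , cover) → (S⊆C ∘ p─q⊆p S ⁅ v ⁆ , cover) , S⊆C v∈S) ⟩
    count (covers⊇? (S - v) ∩? (v ∈?_)) + numVCavoiding (S - v) v
      ≡⟨ count-partition (covers⊇? (S - v)) (v ∈?_) ⟩
    numVCcontaining G (S - v) ∎
    where open ≤-Reasoning

  numVCcontaining-remove-≤ : ∀ {S} v → v ∈ S →
    numVCcontaining G S * (1 + 2 ^ degree G) ≤ 2 ^ degree G * numVCcontaining G (S - v)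
  numVCcontaining-remove-≤ {S} v v∈S = begin
    A * (1 + D)     ≡⟨ *-comm A (1 + D) ⟩
    A + D * A       ≤⟨ +-monoˡ-≤ (D * A) (numVCcontaining≤2^degree*numVCavoiding v v∈S) ⟩
    D * B + D * A   ≡⟨ *-distribˡ-+ D B A ⟨
    D * (B + A)     ≡⟨ cong (D *_) (+-comm B A) ⟩
    D * (A + B)     ≤⟨ *-monoʳ-≤ D (numVCcontaining+numVCavoiding≤numVCcontaining v v∈S) ⟩
    D * numVCcontaining G (S - v) ∎
    where
    open ≤-Reasoning
    A = numVCcontaining G S
    B = numVCavoiding (S - v) v
    D = 2 ^ degree G

  numVCcontaining-bound : ∀ k S → ∣ S ∣ ≡ k →
    numVCcontaining G S * (1 + 2 ^ degree G) ^ k ≤ (2 ^ degree G) ^ k * numVC G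
  numVCcontaining-bound zero S _ = begin
    numVCcontaining G S * 1 ≡⟨ *-identityʳ _ ⟩
    numVCcontaining G S     ≤⟨ count-mono (covers⊇? S) (isVertexCover? G) proj₂ ⟩
    numVC G                 ≡⟨ *-identityˡ _ ⟨
    1 * numVC G             ∎
    where open ≤-Reasoning
  numVCcontaining-bound (suc k) S ∣S∣≡1+k with nonempty? S
  ... | no S-empty =
    contradiction (trans (sym ∣S∣≡1+k) (trans (cong ∣_∣ (Empty-unique S-empty)) (∣⊥∣≡0 n))) λ ()
  ... | yes (v , v∈S) = begin
    A * ((1 + D) * E)                ≡⟨ *-assoc A (1 + D) E ⟨
    (A * (1 + D)) * E                ≤⟨ *-monoˡ-≤ E (numVCcontaining-remove-≤ v v∈S) ⟩
    (D * numVCcontaining G S-v) * E  ≡⟨ *-assoc D _ E ⟩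
    D * (numVCcontaining G S-v * E)  ≤⟨ *-monoʳ-≤ D (numVCcontaining-bound k S-v ∣S-v∣≡k) ⟩
    D * (D ^ k * numVC G)            ≡⟨ *-assoc D (D ^ k) _ ⟨
    D ^ suc k * numVC G              ∎
    where
    open ≤-Reasoning
    A = numVCcontaining G S
    D = 2 ^ degree G
    E = (1 + D) ^ k
    S-v = S - v
    ∣S-v∣≡k : ∣ S-v ∣ ≡ k
    ∣S-v∣≡k = suc-injective (trans (sym (x∈p⇒∣p∣≡1+∣p-x∣ v∈S)) ∣S∣≡1+k)

corollary16 : ∀ {n} (G : Graph n) (d : ℕ) → degree G ≡ d → (S : Subset n) →
    numVCcontaining G S * (1 + 2 ^ d) ^ ∣ S ∣ ≤ (2 ^ d) ^ ∣ S ∣ * numVC G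
corollary16 G _ refl S = numVCcontaining-bound G ∣ S ∣ S refl
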